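{- Let $T$ be an unrooted binary phylogenetic $X$-tree, $f_2$ a two-state character on $X$, and $g_2$ an optimal extension of $f_2$ to $T$. Consider the forest obtained from $T$ by deleting all mutation edges of $g_2$, i.e. edges $\{u,v\}$ with $g_2(u)\neq g_2(v)$. Then every vertex of degree 0 in this forest is a leaf of $T$ (labelled by a taxon of $X$), and every vertex of degree 1 in this forest is a leaf of $T$ (labelled by a taxon of $X$).
   Context: An unrooted binary phylogenetic $X$-tree: internal vertices of degree 3, leaves bijectively labelled by $X$. A two-state character is a surjective $f:X\to\mathcal{C}$ with $|\mathcal{C}|=2$. An extension $h:V(T)\to\mathcal{C}$ agrees with $f$ on $X$; $l_h(T)$ counts edges $\{u,v\}$ with $h(u)\neq h(v)$; $l_f(T)=\min_h l_h(T)$; $h$ is optimal if $l_h(T)=l_f(T)$. -}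

module Defs where

open import Data.Nat using (ℕ; zero; suc; _∸_; _≤_)
open import Data.Bool using (Bool; true; false; _∨_; _xor_; not)
open import Data.Fin using (Fin; _≟_)
open import Data.List using (List; length; filter; map)
open import Data.Product using (_×_; _,_; proj₁; proj₂; ∃)
open import Data.Sum using (_⊎_)
open import Data.List.Membership.Propositional using (_∈_)
open import Relation.Nullary using (does)
open import Relation.Nullary.Decidable using (⌊_⌋)
open import Relation.Binary.PropositionalEquality using (_≡_)
open import Relation.Binary.Construct.Closure.ReflexiveTransitive using (Star)
open import Function.Definitions using (Injective)

-- An (undirected multi)graph on vertex set Fin n, given by a list of edges {u,v}
-- (each edge listed once, in some orientation).
Edges : ℕ → Set
Edges n = List (Fin n × Fin n)

Adj : ∀ {n} → Edges n → Fin n → Fin n → Set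
Adj E u v = ((u , v) ∈ E) ⊎ ((v , u) ∈ E)

Connected : ∀ {n} → Edges n → Set
Connected {n} E = ∀ (u v : Fin n) → Star (Adj E) u v

IsTree : ∀ n → Edges n → Set
IsTree n E = (1 ≤ n) × Connected E × (length E ≡ n ∸ 1)

incidentᵇ : ∀ {n} → Fin n → Fin n × Fin n → Bool
incidentᵇ v (a , b) = does (a ≟ v) ∨ does (b ≟ v)

degree : ∀ {n} → Edges n → Fin n → ℕ
degree E v = length (filter (λ e → incidentᵇ v e Data.Bool.≟ true) E)

-- An unrooted binary phylogenetic X-tree with X = Fin m:
-- a tree whose vertices all have degree ≤ 1 (leaves) or exactly 3 (internal),
-- together with a bijection φ from X onto the set of leaves
-- (the degree-0 case only occurs for the one-vertex tree, |X| = 1).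
record PhyloTree (m : ℕ) : Set where
  field
    n      : ℕ
    edges  : Edges n
    isTree : IsTree n edges
    label  : Fin m → Fin n
    label-injective : Injective _≡_ _≡_ label
    label-leaves    : ∀ (v : Fin n) → degree edges v ≤ 1 → ∃ λ x → label x ≡ v
    leaves-labelled : ∀ (x : Fin m) → degree edges (label x) ≤ 1
    internal-deg3   : ∀ (v : Fin n) → degree edges v ≤ 1 ⊎ degree edges v ≡ 3

open PhyloTree public

IsTwoStateCharacter : ∀ {m} → (Fin m → Bool) → Set
IsTwoStateCharacter {m} f = (∃ λ x → f x ≡ true) × (∃ λ y → f y ≡ false)

IsExtension : ∀ {m} (T : PhyloTree m) → (Fin m → Bool) → (Fin (n T) → Bool) → Set
IsExtension T f h = ∀ x → h (label T x) ≡ f x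

mutationᵇ : ∀ {k} → (Fin k → Bool) → Fin k × Fin k → Bool
mutationᵇ h (a , b) = h a xor h b

changes : ∀ {m} (T : PhyloTree m) → (Fin (n T) → Bool) → ℕ
changes T h = length (filter (λ e → mutationᵇ h e Data.Bool.≟ true) (edges T))

IsOptimalExtension : ∀ {m} (T : PhyloTree m) → (Fin m → Bool) → (Fin (n T) → Bool) → Set
IsOptimalExtension T f h =
  IsExtension T f h × (∀ h' → IsExtension T f h' → changes T h ≤ changes T h')

forestEdges : ∀ {m} (T : PhyloTree m) → (Fin (n T) → Bool) → Edges (n T)
forestEdges T h = filter (λ e → mutationᵇ h e Data.Bool.≟ false) (edges T)

{-# OPTIONS --safe #-}
-- If an internal vertex v kept at most one of its three edges in the forest,
-- toggling the state of v would turn its (at least two) mutation edges into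
-- non-mutations at the price of at most one new mutation, contradicting
-- optimality. In general, toggling v changes the length by
-- deg v − 2·(forest degree of v), so optimality forces every internal vertex
-- to keep at least half of its edges, hence at least two of three.
module Submission where

open import Defs
open import Data.Nat using (ℕ; suc; _+_; _*_; _≤_; _<_; z≤n; s≤s)
open import Data.Nat.Properties
  using (≤-refl; ≤-trans; <⇒≱; +-mono-≤; +-monoˡ-≤; +-cancelˡ-≤; *-monoʳ-≤; *-distribˡ-+; +-commutativeSemigroup; module ≤-Reasoning)
open import Algebra.Properties.CommutativeSemigroup +-commutativeSemigroup using (interchange)
open import Data.Bool using (Bool; true; false; not; _∧_; if_then_else_)
import Data.Bool as B
open import Data.Fin using (Fin; _≟_)
open import Data.List using (List; []; _∷_; length; filter)
open import Data.Product using (∃; _×_; _,_)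
open import Data.Sum using (inj₁; inj₂)
open import Data.Empty using (⊥-elim)
open import Relation.Nullary using (yes; no; does)
open import Relation.Binary.PropositionalEquality using (_≡_; refl; sym; cong; subst)

boolToℕ : Bool → ℕ
boolToℕ true  = 1
boolToℕ false = 0

count : ∀ {A : Set} → (A → Bool) → List A → ℕ
count p xs = length (filter (λ x → p x B.≟ true) xs)

count-∷ : ∀ {A : Set} (p : A → Bool) x xs → count p (x ∷ xs) ≡ boolToℕ (p x) + count p xs
count-∷ p x xs with p x
... | true  = refl
... | false = refl

count-filter-false : ∀ {A : Set} (p q : A → Bool) xs →
  count p (filter (λ x → q x B.≟ false) xs) ≡ count (λ x → not (q x) ∧ p x) xs
count-filter-false p q [] = refl
count-filter-false p q (x ∷ xs) with q x
... | true  = count-filter-false p q xs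
... | false with p x
...   | true  = cong suc (count-filter-false p q xs)
...   | false = count-filter-false p q xs

count-bound : ∀ {A : Set} (p q r s : A → Bool) →
  (∀ x → boolToℕ (p x) + boolToℕ (q x) ≤ boolToℕ (r x) + 2 * boolToℕ (s x)) →
  ∀ xs → count p xs + count q xs ≤ count r xs + 2 * count s xs
count-bound p q r s bound [] = z≤n
count-bound p q r s bound (x ∷ xs)
  rewrite count-∷ p x xs | count-∷ q x xs | count-∷ r x xs | count-∷ s x xs = begin
    (⟦ p ⟧ + count p xs) + (⟦ q ⟧ + count q xs)   ≡⟨ interchange ⟦ p ⟧ _ ⟦ q ⟧ _ ⟩
    (⟦ p ⟧ + ⟦ q ⟧) + (count p xs + count q xs)   ≤⟨ +-mono-≤ (bound x) (count-bound p q r s bound xs) ⟩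
    (⟦ r ⟧ + 2 * ⟦ s ⟧) + (count r xs + 2 * count s xs) ≡⟨ interchange ⟦ r ⟧ _ (count r xs) _ ⟩
    (⟦ r ⟧ + count r xs) + (2 * ⟦ s ⟧ + 2 * count s xs) ≡⟨ cong ((⟦ r ⟧ + count r xs) +_) (sym (*-distribˡ-+ 2 ⟦ s ⟧ (count s xs))) ⟩
    (⟦ r ⟧ + count r xs) + 2 * (⟦ s ⟧ + count s xs) ∎
  where
  open ≤-Reasoning
  ⟦_⟧ : (_ → Bool) → ℕ
  ⟦ t ⟧ = boolToℕ (t x)

toggleAt : ∀ {k} → (Fin k → Bool) → Fin k → Fin k → Bool
toggleAt h v u = if does (u ≟ v) then not (h v) else h u

-- Equality holds except on a loop at v, which the edge-list encoding does not exclude.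
toggleAt-edge-bound : ∀ {k} (h : Fin k → Bool) (v : Fin k) e →
  boolToℕ (mutationᵇ (toggleAt h v) e) + boolToℕ (incidentᵇ v e)
    ≤ boolToℕ (mutationᵇ h e) + 2 * boolToℕ (not (mutationᵇ h e) ∧ incidentᵇ v e)
toggleAt-edge-bound h v (a , b) with a ≟ v | b ≟ v
... | yes refl | yes refl with h a
...   | true  = s≤s z≤n
...   | false = s≤s z≤n
toggleAt-edge-bound h v (a , b) | yes refl | no _ with h a | h b
...   | true  | true  = ≤-refl
...   | true  | false = ≤-refl
...   | false | true  = ≤-refl
...   | false | false = ≤-refl
toggleAt-edge-bound h v (a , b) | no _ | yes refl with h a | h b
...   | true  | true  = ≤-refl
...   | true  | false = ≤-refl
...   | false | true  = ≤-refl
...   | false | false = ≤-refl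
toggleAt-edge-bound h v (a , b) | no _ | no _ with h a | h b
...   | true  | true  = ≤-refl
...   | true  | false = ≤-refl
...   | false | true  = ≤-refl
...   | false | false = ≤-refl

changes-toggleAt : ∀ {m} (T : PhyloTree m) (h : Fin (n T) → Bool) (v : Fin (n T)) →
  changes T (toggleAt h v) + degree (edges T) v ≤ changes T h + 2 * degree (forestEdges T h) v
changes-toggleAt T h v
  rewrite count-filter-false (incidentᵇ v) (mutationᵇ h) (edges T) =
  count-bound (mutationᵇ (toggleAt h v)) (incidentᵇ v) (mutationᵇ h)
              (λ e → not (mutationᵇ h e) ∧ incidentᵇ v e) (toggleAt-edge-bound h v) (edges T)

toggleAt-internal-extension : ∀ {m} (T : PhyloTree m) f h v → 1 < degree (edges T) v →
  IsExtension T f h → IsExtension T f (toggleAt h v)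
toggleAt-internal-extension T f h v internal ext x with label T x ≟ v
... | yes refl = ⊥-elim (<⇒≱ internal (leaves-labelled T x))
... | no _     = ext x

optimal-internal-majority : ∀ {m} (T : PhyloTree m) f h v → IsOptimalExtension T f h →
  1 < degree (edges T) v → degree (edges T) v ≤ 2 * degree (forestEdges T h) v
optimal-internal-majority T f h v (ext , opt) internal =
  +-cancelˡ-≤ (changes T (toggleAt h v)) _ _
    (≤-trans (changes-toggleAt T h v)
             (+-monoˡ-≤ _ (opt (toggleAt h v) (toggleAt-internal-extension T f h v internal ext))))

optimal-forest-leaf : ∀ {m} (T : PhyloTree m) f h v → IsOptimalExtension T f h →
  degree (forestEdges T h) v ≤ 1 → ∃ λ x → label T x ≡ v
optimal-forest-leaf T f h v opt forest≤1 with internal-deg3 T v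
... | inj₁ leaf = label-leaves T v leaf
... | inj₂ deg3 = ⊥-elim (<⇒≱ (s≤s (s≤s (s≤s z≤n))) 3≤2)
  where
  3≤2 : 3 ≤ 2
  3≤2 = subst (_≤ 2) deg3
          (≤-trans (optimal-internal-majority T f h v opt (subst (1 <_) (sym deg3) (s≤s (s≤s z≤n))))
                   (*-monoʳ-≤ 2 forest≤1))

mainTheorem12 : ∀ {m} (T : PhyloTree m) (f₂ : Fin m → Bool) (g₂ : Fin (n T) → Bool) →
    IsTwoStateCharacter f₂ → IsOptimalExtension T f₂ g₂ →
    (∀ (v : Fin (n T)) → degree (forestEdges T g₂) v ≡ 0 → ∃ λ x → label T x ≡ v) ×
    (∀ (v : Fin (n T)) → degree (forestEdges T g₂) v ≡ 1 → ∃ λ x → label T x ≡ v)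
mainTheorem12 T f₂ g₂ _ opt =
  (λ v deg0 → optimal-forest-leaf T f₂ g₂ v opt (subst (_≤ 1) (sym deg0) z≤n)) ,
  (λ v deg1 → optimal-forest-leaf T f₂ g₂ v opt (subst (_≤ 1) (sym deg1) ≤-refl))
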